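{- Let $d=2$ and $n=2^\delta$ for an integer $\delta\ge 0$. Let $G$ be a graph on $n$ vertices and let $\sigma$ be a growth schedule for $G$ with $\log n$ slots. Then $\sigma$ uses at least $\min_{b} ED_b$ excess edges, where the minimum is over all bijections $b: V(G_{min})\to V(G)$ and $ED_b=|\{uv\in E(G_{min}) : b(u)b(v)\notin E(G)\}|$.
   Context: Growth schedules with edge-activation distance $d$ (a fixed positive integer). A growth schedule of $k$ slots produces graphs $G_0,\dots,G_k$, where $G_0=(\{u_0\},\emptyset)$ is a single vertex. In slot $t$ the process sets $G_t=G_{t-1}$; for every $u\in V(G_{t-1})$ it may add at most one new vertex $u'$ with the edge $uu'$ and any subset of the edges $\{vu' : v\in V(G_{t-1}),\ \mathrm{dist}_{G_{t-1}}(u,v)\le d-1\}$; finally it deletes any set of edges of $G_t$ whose deletion does not disconnect $G_t$. Deleted edges are excess edges; their total number over all slots is the number of excess edges. The schedule grows $G$ if $G_k\cong G$. The graph $G_{min}$ on $n=2^\delta$ vertices is defined as follows: start from a single vertex and perform $\delta$ rounds; in each round, for every existing vertex $u$ add a new vertex $u'$ and the single edge $uu'$ (and no other edges). Logarithms are base 2. -}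

module Defs where

open import Data.Nat using (ℕ; zero; suc; _+_; _^_; _≤_; _∸_; _<ᵇ_; _≡ᵇ_)
open import Data.Bool using (Bool; true; false; _∧_; _∨_; not; if_then_else_)
open import Data.Fin using (Fin; toℕ; splitAt; _≟_)
open import Data.List using (List; map; allFin)
open import Data.Nat.ListAction using (sum)
open import Data.Sum using (inj₁; inj₂)
open import Data.Product using (Σ; ∃; _×_)
open import Relation.Binary.PropositionalEquality using (_≡_)
open import Relation.Nullary.Decidable using (⌊_⌋)
open import Function.Definitions using (Injective)
open import Function.Bundles using (_⤖_; Bijection)

record Graph (n : ℕ) : Set where
  field
    adj    : Fin n → Fin n → Bool
    sym    : ∀ i j → adj i j ≡ adj j i
    irrefl : ∀ i → adj i i ≡ false
open Graph public

data Walk {n : ℕ} (A : Fin n → Fin n → Bool) : Fin n → Fin n → ℕ → Set where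
  nil  : ∀ {u} → Walk A u u 0
  cons : ∀ {u w v k} → A u w ≡ true → Walk A w v k → Walk A u v (suc k)

DistLe : {n : ℕ} → (Fin n → Fin n → Bool) → Fin n → Fin n → ℕ → Set
DistLe A u v r = Σ ℕ (λ k → k ≤ r × Walk A u v k)

Connected : {n : ℕ} → Graph n → Set
Connected G = ∀ u v → Σ ℕ (λ k → Walk (adj G) u v k)

countPairs : {n : ℕ} → (Fin n → Fin n → Bool) → ℕ
countPairs {n} P =
  sum (map (λ i → sum (map (λ j → if (toℕ i <ᵇ toℕ j) ∧ P i j then 1 else 0) (allFin n))) (allFin n))

G₀ : Graph 1
G₀ = record { adj = λ _ _ → false ; sym = λ _ _ → _≡_.refl ; irrefl = λ _ → _≡_.refl }

-- Graph after the additions of a slot (before deletions).  Old vertices are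
-- Fin m (first block), the k new vertices are the second block; new vertex j
-- is the child of parent j, joined to parent j and to the chosen old vertices
-- extra j v.
slotAdj : {m : ℕ} (H : Graph m) (k : ℕ) (parent : Fin k → Fin m)
          (extra : Fin k → Fin m → Bool) → Fin (m + k) → Fin (m + k) → Bool
slotAdj {m} H k parent extra a b with splitAt m a | splitAt m b
... | inj₁ i | inj₁ j = adj H i j
... | inj₁ i | inj₂ j = ⌊ parent j ≟ i ⌋ ∨ extra j i
... | inj₂ i | inj₁ j = ⌊ parent i ≟ j ⌋ ∨ extra i j
... | inj₂ _ | inj₂ _ = false

record Slot (d : ℕ) {m : ℕ} (H : Graph m) : Set where
  field
    k          : ℕ
    parent     : Fin k → Fin m
    parent-inj : Injective _≡_ _≡_ parent          -- at most one new vertex per u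
    extra      : Fin k → Fin m → Bool
    extra-ok   : ∀ j v → extra j v ≡ true → DistLe (adj H) (parent j) v (d ∸ 1)
    result     : Graph (m + k)                     -- G_t after deletions
    result-sub : ∀ a b → adj result a b ≡ true → slotAdj H k parent extra a b ≡ true
    result-con : Connected result
  excess : ℕ
  excess = countPairs (λ a b → slotAdj H k parent extra a b ∧ not (adj result a b))

-- Schedule d H s m' F e : a growth schedule of s slots starting from H,
-- ending in F (on m' vertices), with e excess edges in total.
data Schedule (d : ℕ) {m : ℕ} (H : Graph m) : ℕ → (m' : ℕ) → Graph m' → ℕ → Set where
  done : Schedule d H 0 m H 0
  step : ∀ {s m' F e} (σ : Slot d H) →
         Schedule d (Slot.result σ) s m' F e →
         Schedule d H (suc s) m' F (Slot.excess σ + e)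

Iso : {m n : ℕ} → Graph m → Graph n → Set
Iso {m} {n} F G = Σ (Fin m ⤖ Fin n) (λ f → ∀ i j → adj G (Bijection.to f i) (Bijection.to f j) ≡ adj F i j)

-- G_min edges on vertices 0..2^δ-1: in round r (0-based), vertex u < 2^r gets
-- the new vertex u + 2^r and the edge {u, u+2^r}.
gminE : ℕ → ℕ → ℕ → Bool
gminE zero    a b = false
gminE (suc r) a b = gminE r a b
                    ∨ ((a <ᵇ 2 ^ r) ∧ (b ≡ᵇ a + 2 ^ r))
                    ∨ ((b <ᵇ 2 ^ r) ∧ (a ≡ᵇ b + 2 ^ r))

Gmin-adj : (δ : ℕ) → Fin (2 ^ δ) → Fin (2 ^ δ) → Bool
Gmin-adj δ i j = gminE δ (toℕ i) (toℕ j)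

ED : (δ : ℕ) → Graph (2 ^ δ) → (Fin (2 ^ δ) ⤖ Fin (2 ^ δ)) → ℕ
ED δ G b = countPairs (λ u v → Gmin-adj δ u v ∧ not (adj G (Bijection.to b u) (Bijection.to b v)))

-- Label the vertices of G_t injectively by {0, …, 2^t − 1}: the vertex of G₀ gets 0, and in
-- every slot old vertices keep their labels while the child of u gets 2^t + label(u).  Under
-- these labels every G_min(t+1)-edge is either a G_min(t)-edge between old vertices or the
-- edge from a new vertex to its parent.  So the number of G_min-edges missing from G_t grows
-- in each slot by at most the number of edges deleted in it, and after log n slots the
-- labelling is a bijection b with ED_b at most the number of excess edges.

module Submission where

open import Defs hiding (sym)
open import Data.Nat using (ℕ; zero; suc; _+_; _*_; _^_; _≤_; _<_; _<ᵇ_; _≡ᵇ_; z≤n; s≤s)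
open import Data.Nat.Properties
open import Data.Bool using (Bool; true; false; _∧_; _∨_; not; T; if_then_else_)
open import Data.Bool.Properties using (∨-comm; ¬-not; T-≡; T-∧; T-∨)
open import Data.Fin using (Fin; toℕ; fromℕ<; splitAt; _↑ˡ_; _↑ʳ_; punchOut)
  renaming (zero to fzero; suc to fsuc)
import Data.Fin as Fin
open import Data.Fin.Properties
  using (toℕ-injective; toℕ-fromℕ<; splitAt-↑ˡ; splitAt-↑ʳ; injective⇒≤; punchOut-injective; any?)
open import Data.Fin.Permutation using (Permutation; _⟨$⟩ʳ_)
open import Data.List using (map; allFin; tabulate)
open import Data.List.Properties using (map-tabulate)
import Data.Nat.ListAction as List
open import Data.Vec.Functional using (_++_)
open import Data.Vec.Functional.Properties using (lookup-++ˡ; lookup-++ʳ)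
open import Data.Sum using (_⊎_; inj₁; inj₂; map₂)
open import Data.Product using (Σ; _×_; _,_; proj₁; proj₂)
open import Data.Empty using (⊥-elim)
open import Relation.Nullary using (¬_; yes; no)
open import Relation.Binary using (tri<; tri≈; tri>)
open import Relation.Binary.PropositionalEquality
open import Function.Base using (_∘_; const)
open import Function.Bundles using (_⤖_; _↔_; Bijection; Inverse; Injection; Equivalence; mk⤖)
open import Function.Definitions using (Injective; Surjective)
open import Function.Construct.Composition using (_⤖-∘_)
open import Function.Construct.Symmetry using (↔-sym)
open import Function.Properties.Bijection using (⤖⇒↔)
open import Function.Properties.Inverse using (↔⇒⤖; ↔⇒↣)
open import Data.Nat.Tactic.RingSolver using (solve-∀)
open import Algebra.Properties.CommutativeMonoid.Sum +-0-commutativeMonoid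
  using (sum; ∑-comm; sum-permute; sum-cong-≗; ∑-distrib-+; sum-replicate-zero)

Rel : ℕ → Set
Rel n = Fin n → Fin n → Bool

_∖_ : ∀ {n} → Rel n → Rel n → Rel n
(A ∖ B) i j = A i j ∧ not (B i j)

Symmetric : ∀ {n} → Rel n → Set
Symmetric A = ∀ i j → A i j ≡ A j i

Irreflexive : ∀ {n} → Rel n → Set
Irreflexive A = ∀ i → A i i ≡ false

∖-symmetric : ∀ {n} {A B : Rel n} → Symmetric A → Symmetric B → Symmetric (A ∖ B)
∖-symmetric A-sym B-sym i j = cong₂ (λ x y → x ∧ not y) (A-sym i j) (B-sym i j)

∖-irreflexive : ∀ {n} (A B : Rel n) → Irreflexive A → Irreflexive (A ∖ B)
∖-irreflexive A B A-irr i = cong (_∧ not (B i i)) (A-irr i)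

≡true⇒T : ∀ {b} → b ≡ true → T b
≡true⇒T = Equivalence.from T-≡

T⇒≡true : ∀ {b} → T b → b ≡ true
T⇒≡true = Equivalence.to T-≡

¬T⇒≡false : ∀ {b} → ¬ T b → b ≡ false
¬T⇒≡false ¬b = ¬-not (¬b ∘ ≡true⇒T)

sum-mono : ∀ {n} {f g : Fin n → ℕ} → (∀ i → f i ≤ g i) → sum f ≤ sum g
sum-mono {zero}  f≤g = z≤n
sum-mono {suc n} f≤g = +-mono-≤ (f≤g fzero) (sum-mono (f≤g ∘ fsuc))

sum-zero : ∀ {n} {f : Fin n → ℕ} → (∀ i → f i ≡ 0) → sum f ≡ 0
sum-zero {n} f≡0 = trans (sum-cong-≗ f≡0) (sum-replicate-zero n)

sum-↑ : ∀ m k (f : Fin (m + k) → ℕ) → sum f ≡ sum (f ∘ (_↑ˡ k)) + sum (f ∘ (m ↑ʳ_))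
sum-↑ zero    k f = refl
sum-↑ (suc m) k f = trans (cong (f fzero +_) (sum-↑ m k (f ∘ fsuc))) (sym (+-assoc (f fzero) _ _))

listSum-allFin : ∀ n (f : Fin n → ℕ) → List.sum (map f (allFin n)) ≡ sum f
listSum-allFin n f = trans (cong List.sum (map-tabulate (λ i → i) f)) (sum-tabulate n f)
  where
  sum-tabulate : ∀ n (f : Fin n → ℕ) → List.sum (tabulate f) ≡ sum f
  sum-tabulate zero    f = refl
  sum-tabulate (suc n) f = cong (f fzero +_) (sum-tabulate n (f ∘ fsuc))

⟦_⟧ : Bool → ℕ
⟦ b ⟧ = if b then 1 else 0

⟦⟧-mono : ∀ {a b} → (T a → T b) → ⟦ a ⟧ ≤ ⟦ b ⟧
⟦⟧-mono {false}         a⇒b = z≤n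
⟦⟧-mono {true}  {true}  a⇒b = ≤-refl
⟦⟧-mono {true}  {false} a⇒b = ⊥-elim (a⇒b _)

⟦⟧-∨ : ∀ a b → ⟦ a ∨ b ⟧ ≤ ⟦ a ⟧ + ⟦ b ⟧
⟦⟧-∨ false b = ≤-refl
⟦⟧-∨ true  b = s≤s z≤n

orderedCount : ∀ {n} → Rel n → ℕ
orderedCount P = sum λ i → sum λ j → ⟦ P i j ⟧

orderedCount-mono : ∀ {n} {P Q : Rel n} → (∀ i j → T (P i j) → T (Q i j)) →
                    orderedCount P ≤ orderedCount Q
orderedCount-mono P⇒Q = sum-mono λ i → sum-mono λ j → ⟦⟧-mono (P⇒Q i j)

orderedCount-∨ : ∀ {n} (P Q : Rel n) →
                 orderedCount (λ i j → P i j ∨ Q i j) ≤ orderedCount P + orderedCount Q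
orderedCount-∨ P Q = begin
  orderedCount (λ i j → P i j ∨ Q i j)
    ≤⟨ sum-mono (λ i → sum-mono λ j → ⟦⟧-∨ (P i j) (Q i j)) ⟩
  sum (λ i → sum λ j → ⟦ P i j ⟧ + ⟦ Q i j ⟧)
    ≡⟨ sum-cong-≗ (λ i → ∑-distrib-+ (λ j → ⟦ P i j ⟧) (λ j → ⟦ Q i j ⟧)) ⟩
  sum (λ i → sum (λ j → ⟦ P i j ⟧) + sum (λ j → ⟦ Q i j ⟧))
    ≡⟨ ∑-distrib-+ (λ i → sum λ j → ⟦ P i j ⟧) (λ i → sum λ j → ⟦ Q i j ⟧) ⟩
  orderedCount P + orderedCount Q ∎
  where open ≤-Reasoning

orderedCount-reindex : ∀ {m n} (π : Permutation m n) (P : Rel n) →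
                       orderedCount P ≡ orderedCount (λ i j → P (π ⟨$⟩ʳ i) (π ⟨$⟩ʳ j))
orderedCount-reindex π P =
  trans (sum-permute _ π) (sum-cong-≗ λ i → sum-permute (λ j → ⟦ P (π ⟨$⟩ʳ i) j ⟧) π)

orderedCount-symmetric : ∀ {n} (P : Rel n) → Symmetric P → Irreflexive P →
                         orderedCount P ≡ 2 * countPairs P
orderedCount-symmetric {n} P P-sym P-irr = begin
  orderedCount P
    ≡⟨ sum-cong-≗ (λ i → sum-cong-≗ (split i)) ⟩
  sum (λ i → sum λ j → below i j + below j i)
    ≡⟨ sum-cong-≗ (λ i → ∑-distrib-+ (below i) (λ j → below j i)) ⟩
  sum (λ i → sum (below i) + sum λ j → below j i)
    ≡⟨ ∑-distrib-+ (sum ∘ below) (λ i → sum λ j → below j i) ⟩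
  C + sum (λ i → sum λ j → below j i)
    ≡⟨ cong (C +_) (sym (∑-comm below)) ⟩
  C + C
    ≡⟨ cong (λ x → x + x) (sym countPairs≡C) ⟩
  countPairs P + countPairs P
    ≡⟨ cong (countPairs P +_) (sym (+-identityʳ _)) ⟩
  2 * countPairs P ∎
  where
  open ≡-Reasoning
  below : Fin n → Fin n → ℕ
  below i j = ⟦ (toℕ i <ᵇ toℕ j) ∧ P i j ⟧

  C : ℕ
  C = sum (sum ∘ below)

  countPairs≡C : countPairs P ≡ C
  countPairs≡C = trans (listSum-allFin n _) (sum-cong-≗ λ i → listSum-allFin n (below i))

  <ᵇ-true : ∀ {a b} → a < b → (a <ᵇ b) ≡ true
  <ᵇ-true = T⇒≡true ∘ <⇒<ᵇ

  <ᵇ-false : ∀ {a b} → ¬ a < b → (a <ᵇ b) ≡ false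
  <ᵇ-false {a} {b} a≮b = ¬T⇒≡false (a≮b ∘ <ᵇ⇒< a b)

  split : ∀ i j → ⟦ P i j ⟧ ≡ below i j + below j i
  split i j with <-cmp (toℕ i) (toℕ j)
  ... | tri< i<j _ j≮i rewrite <ᵇ-true i<j | <ᵇ-false j≮i = sym (+-identityʳ _)
  ... | tri> i≮j _ j<i rewrite <ᵇ-false i≮j | <ᵇ-true j<i = cong ⟦_⟧ (P-sym i j)
  ... | tri≈ i≮j i≡j _ rewrite toℕ-injective i≡j | <ᵇ-false i≮j | P-irr j = refl

data Block (m k : ℕ) : Fin (m + k) → Set where
  old : (i : Fin m) → Block m k (i ↑ˡ k)
  new : (j : Fin k) → Block m k (m ↑ʳ j)

block : ∀ m {k} (a : Fin (m + k)) → Block m k a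
block zero    a        = new a
block (suc m) fzero    = old fzero
block (suc m) (fsuc a) with block m a
... | old i = old (fsuc i)
... | new j = new j

extendOld : ∀ {m} k → Rel m → Rel (m + k)
extendOld k P = (λ i → P i ++ const false) ++ const (const false)

extendOld-old : ∀ {m} k (P : Rel m) i j → extendOld k P (i ↑ˡ k) (j ↑ˡ k) ≡ P i j
extendOld-old {m} k P i j rewrite splitAt-↑ˡ m i k | splitAt-↑ˡ m j k = refl

orderedCount-extendOld : ∀ {m} k (P : Rel m) → orderedCount (extendOld k P) ≡ orderedCount P
orderedCount-extendOld {m} k P = begin
  orderedCount (extendOld k P)
    ≡⟨ sum-↑ m k _ ⟩
  sum (λ i → row (i ↑ˡ k)) + sum (λ j → row (m ↑ʳ j))
    ≡⟨ cong₂ _+_ (sum-cong-≗ old-row) (sum-zero new-row) ⟩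
  orderedCount P + 0
    ≡⟨ +-identityʳ _ ⟩
  orderedCount P ∎
  where
  open ≡-Reasoning
  row : Fin (m + k) → ℕ
  row a = sum λ b → ⟦ extendOld k P a b ⟧

  padded : Fin m → Fin (m + k) → Bool
  padded i = P i ++ const false

  old-row : ∀ i → row (i ↑ˡ k) ≡ sum λ j → ⟦ P i j ⟧
  old-row i rewrite splitAt-↑ˡ m i k = begin
    sum (λ b → ⟦ padded i b ⟧)
      ≡⟨ sum-↑ m k _ ⟩
    sum (λ j → ⟦ padded i (j ↑ˡ k) ⟧) + sum (λ j → ⟦ padded i (m ↑ʳ j) ⟧)
      ≡⟨ cong₂ _+_ (sum-cong-≗ λ j → cong ⟦_⟧ (lookup-++ˡ (P i) (const false) j))
                   (sum-zero λ j → cong ⟦_⟧ (lookup-++ʳ (P i) (λ (_ : Fin k) → false) j)) ⟩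
    sum (λ j → ⟦ P i j ⟧) + 0
      ≡⟨ +-identityʳ _ ⟩
    sum (λ j → ⟦ P i j ⟧) ∎

  new-row : ∀ j → row (m ↑ʳ j) ≡ 0
  new-row j rewrite splitAt-↑ʳ m k j = sum-replicate-zero (m + k)

module _ {m} (H : Graph m) (k : ℕ) (parent : Fin k → Fin m) (extra : Fin k → Fin m → Bool) where

  slotAdj-old-old : ∀ i j → slotAdj H k parent extra (i ↑ˡ k) (j ↑ˡ k) ≡ adj H i j
  slotAdj-old-old i j rewrite splitAt-↑ˡ m i k | splitAt-↑ˡ m j k = refl

  slotAdj-parent-child : ∀ j → T (slotAdj H k parent extra (parent j ↑ˡ k) (m ↑ʳ j))
  slotAdj-parent-child j rewrite splitAt-↑ˡ m (parent j) k | splitAt-↑ʳ m k j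
    with parent j Fin.≟ parent j
  ... | yes _  = _
  ... | no p≢p = ⊥-elim (p≢p refl)

  slotAdj-symmetric : Symmetric (slotAdj H k parent extra)
  slotAdj-symmetric a b with block m a | block m b
  ... | old i | old j rewrite splitAt-↑ˡ m i k | splitAt-↑ˡ m j k = Graph.sym H i j
  ... | old i | new j rewrite splitAt-↑ˡ m i k | splitAt-↑ʳ m k j = refl
  ... | new i | old j rewrite splitAt-↑ʳ m k i | splitAt-↑ˡ m j k = refl
  ... | new i | new j rewrite splitAt-↑ʳ m k i | splitAt-↑ʳ m k j = refl

  slotAdj-irreflexive : Irreflexive (slotAdj H k parent extra)
  slotAdj-irreflexive a with block m a
  ... | old i rewrite splitAt-↑ˡ m i k = irrefl H i
  ... | new j rewrite splitAt-↑ʳ m k j = refl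

m<n⇒m<2n : ∀ {m n} → m < n → m < 2 * n
m<n⇒m<2n m<n = ≤-trans m<n (m≤m+n _ _)

m<n⇒m+n<2n : ∀ {m n} → m < n → m + n < 2 * n
m<n⇒m+n<2n {n = n} m<n = +-mono-<-≤ m<n (m≤m+n n 0)

m<n⇒n+m<2n : ∀ {m n} → m < n → n + m < 2 * n
m<n⇒n+m<2n {n = n} m<n = +-monoʳ-< n (≤-trans m<n (m≤m+n n 0))

round-edge : ∀ {x y p} → T ((x <ᵇ p) ∧ (y ≡ᵇ x + p)) → x < p × y ≡ x + p
round-edge t with x<p , y≡x+p ← Equivalence.to T-∧ t = <ᵇ⇒< _ _ x<p , ≡ᵇ⇒≡ _ _ y≡x+p

gminE-suc⇒ : ∀ {r a b} → T (gminE (suc r) a b) →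
             T (gminE r a b) ⊎ (a < 2 ^ r × b ≡ a + 2 ^ r) ⊎ (b < 2 ^ r × a ≡ b + 2 ^ r)
gminE-suc⇒ e with Equivalence.to T-∨ e
... | inj₁ earlier = inj₁ earlier
... | inj₂ latest with Equivalence.to T-∨ latest
...   | inj₁ up   = inj₂ (inj₁ (round-edge up))
...   | inj₂ down = inj₂ (inj₂ (round-edge down))

gminE-bounded : ∀ r {a b} → T (gminE r a b) → a < 2 ^ r × b < 2 ^ r
gminE-bounded (suc r) {a} {b} e with gminE-suc⇒ {r} {a} {b} e
... | inj₁ e′ with a< , b< ← gminE-bounded r e′ = m<n⇒m<2n a< , m<n⇒m<2n b<
... | inj₂ (inj₁ (a< , refl))                   = m<n⇒m<2n a< , m<n⇒m+n<2n a<
... | inj₂ (inj₂ (b< , refl))                   = m<n⇒m+n<2n b< , m<n⇒m<2n b<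

gminE-symmetric : ∀ r a b → gminE r a b ≡ gminE r b a
gminE-symmetric zero    a b = refl
gminE-symmetric (suc r) a b = cong₂ _∨_ (gminE-symmetric r a b)
  (∨-comm ((a <ᵇ 2 ^ r) ∧ (b ≡ᵇ a + 2 ^ r)) ((b <ᵇ 2 ^ r) ∧ (a ≡ᵇ b + 2 ^ r)))

gminE-irreflexive : ∀ r a → gminE r a a ≡ false
gminE-irreflexive r a = ¬T⇒≡false (no-loop r)
  where
  no-loop : ∀ r → ¬ T (gminE r a a)
  no-loop (suc r) e with gminE-suc⇒ {r} e
  ... | inj₁ e′              = no-loop r e′
  ... | inj₂ (inj₁ (_ , a≡)) = <-irrefl a≡ (m<m+n a (m^n>0 2 r))
  ... | inj₂ (inj₂ (_ , a≡)) = <-irrefl a≡ (m<m+n a (m^n>0 2 r))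

gminE-suc-low : ∀ {r a b} → a < 2 ^ r → b < 2 ^ r → T (gminE (suc r) a b) → T (gminE r a b)
gminE-suc-low {r} {a} {b} a< b< e with gminE-suc⇒ {r} {a} {b} e
... | inj₁ e′                 = e′
... | inj₂ (inj₁ (_ , refl)) = ⊥-elim (m+n≮n a (2 ^ r) b<)
... | inj₂ (inj₂ (_ , refl)) = ⊥-elim (m+n≮n b (2 ^ r) a<)

gminE-suc-child : ∀ {r a b} → a < 2 ^ r → T (gminE (suc r) a (2 ^ r + b)) → b ≡ a
gminE-suc-child {r} {a} {b} a< e with gminE-suc⇒ {r} {a} e
... | inj₁ e′               = ⊥-elim (m+n≮m (2 ^ r) b (proj₂ (gminE-bounded r e′)))
... | inj₂ (inj₁ (_ , eq))  = +-cancelˡ-≡ (2 ^ r) b a (trans eq (+-comm a (2 ^ r)))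
... | inj₂ (inj₂ (b< , _))  = ⊥-elim (m+n≮m (2 ^ r) b b<)

gminE-suc-children : ∀ {r a b} → ¬ T (gminE (suc r) (2 ^ r + a) (2 ^ r + b))
gminE-suc-children {r} {a} {b} e with gminE-suc⇒ {r} e
... | inj₁ e′               = m+n≮m (2 ^ r) a (proj₁ (gminE-bounded r e′))
... | inj₂ (inj₁ (a< , _))  = m+n≮m (2 ^ r) a a<
... | inj₂ (inj₂ (b< , _))  = m+n≮m (2 ^ r) b b<

record Labelling (m N : ℕ) : Set where
  field
    label     : Fin m → ℕ
    injective : Injective _≡_ _≡_ label
    bounded   : ∀ i → label i < N
open Labelling

-- Counts ordered pairs, i.e. every missing edge twice.
missingEdges : ∀ t {m} → Graph m → (Fin m → ℕ) → ℕ
missingEdges t H ℓ = orderedCount ((λ i j → gminE t (ℓ i) (ℓ j)) ∖ adj H)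

module _ {d m} {H : Graph m} (σ : Slot d H) where
  open Slot σ

  relabel : ℕ → (Fin m → ℕ) → Fin (m + k) → ℕ
  relabel N ℓ = ℓ ++ λ j → N + ℓ (parent j)

  relabel-old : ∀ N ℓ i → relabel N ℓ (i ↑ˡ k) ≡ ℓ i
  relabel-old N ℓ = lookup-++ˡ ℓ _

  relabel-new : ∀ N ℓ j → relabel N ℓ (m ↑ʳ j) ≡ N + ℓ (parent j)
  relabel-new N ℓ = lookup-++ʳ ℓ _

  relabelling : ∀ {N} → Labelling m N → Labelling (m + k) (2 * N)
  relabelling {N} ℓ = record { label = ℓ′ ; injective = ℓ′-injective ; bounded = ℓ′-bounded }
    where
    ℓ′ : Fin (m + k) → ℕ
    ℓ′ = relabel N (label ℓ)

    old-label : ∀ i → ℓ′ (i ↑ˡ k) ≡ label ℓ i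
    old-label = relabel-old N (label ℓ)

    new-label : ∀ j → ℓ′ (m ↑ʳ j) ≡ N + label ℓ (parent j)
    new-label = relabel-new N (label ℓ)

    ℓ′-bounded : ∀ a → ℓ′ a < 2 * N
    ℓ′-bounded a with block m a
    ... | old i rewrite old-label i = m<n⇒m<2n (bounded ℓ i)
    ... | new j rewrite new-label j = m<n⇒n+m<2n (bounded ℓ (parent j))

    ℓ′-injective : Injective _≡_ _≡_ ℓ′
    ℓ′-injective {a} {b} eq with block m a | block m b
    ... | old i | old j = cong (_↑ˡ k) (injective ℓ (subst₂ _≡_ (old-label i) (old-label j) eq))
    ... | old i | new j = ⊥-elim (m+n≮m N _
      (subst (_< N) (subst₂ _≡_ (old-label i) (new-label j) eq) (bounded ℓ i)))
    ... | new i | old j = ⊥-elim (m+n≮m N _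
      (subst (_< N) (subst₂ _≡_ (old-label j) (new-label i) (sym eq)) (bounded ℓ j)))
    ... | new i | new j = cong (m ↑ʳ_) (parent-inj (injective ℓ (+-cancelˡ-≡ N _ _
      (subst₂ _≡_ (new-label i) (new-label j) eq))))

  module _ (t : ℕ) (ℓ : Labelling m (2 ^ t)) where
    ℓ′ : Fin (m + k) → ℕ
    ℓ′ = relabel (2 ^ t) (label ℓ)

    oldMissing : Rel m
    oldMissing = (λ i j → gminE t (label ℓ i) (label ℓ j)) ∖ adj H

    deleted : Rel (m + k)
    deleted = slotAdj H k parent extra ∖ adj result

    private
      old-label : ∀ i → ℓ′ (i ↑ˡ k) ≡ label ℓ i
      old-label = relabel-old (2 ^ t) (label ℓ)

      new-label : ∀ j → ℓ′ (m ↑ʳ j) ≡ 2 ^ t + label ℓ (parent j)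
      new-label = relabel-new (2 ^ t) (label ℓ)

      relabelled : ∀ {a b x y} → ℓ′ a ≡ x → ℓ′ b ≡ y →
                   T (gminE (suc t) (ℓ′ a) (ℓ′ b)) → T (gminE (suc t) x y)
      relabelled = subst₂ (λ x y → T (gminE (suc t) x y))

    gminE-relabel-cover : ∀ a b → T (gminE (suc t) (ℓ′ a) (ℓ′ b)) →
                          T (extendOld k oldMissing a b) ⊎ T (slotAdj H k parent extra a b)
    gminE-relabel-cover a b e with block m a | block m b
    ... | old i | old j rewrite extendOld-old k oldMissing i j | slotAdj-old-old H k parent extra i j
      with adj H i j
    ...   | true  = inj₂ _
    ...   | false = inj₁ (Equivalence.from T-∧ (gminE-suc-low {t} (bounded ℓ i) (bounded ℓ j)
                            (relabelled (old-label i) (old-label j) e) , _))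
    gminE-relabel-cover a b e | old i | new j
      with injective ℓ {parent j} {i}
             (gminE-suc-child {t} (bounded ℓ i) (relabelled (old-label i) (new-label j) e))
    ... | refl = inj₂ (slotAdj-parent-child H k parent extra j)
    gminE-relabel-cover a b e | new i | old j
      with injective ℓ {parent i} {j} (gminE-suc-child {t} (bounded ℓ j)
             (relabelled (old-label j) (new-label i) (subst T (gminE-symmetric (suc t) _ _) e)))
    ... | refl =
      inj₂ (subst T (slotAdj-symmetric H k parent extra _ _) (slotAdj-parent-child H k parent extra i))
    gminE-relabel-cover a b e | new i | new j =
      ⊥-elim (gminE-suc-children {t} (relabelled (new-label i) (new-label j) e))

    missingEdges-slot : missingEdges (suc t) result ℓ′ ≤ 2 * excess + missingEdges t H (label ℓ)
    missingEdges-slot = begin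
      missingEdges (suc t) result ℓ′
        ≤⟨ orderedCount-mono missing-cover ⟩
      orderedCount (λ a b → extendOld k oldMissing a b ∨ deleted a b)
        ≤⟨ orderedCount-∨ (extendOld k oldMissing) deleted ⟩
      orderedCount (extendOld k oldMissing) + orderedCount deleted
        ≡⟨ cong₂ _+_ (orderedCount-extendOld k oldMissing) (orderedCount-symmetric deleted
             (∖-symmetric (slotAdj-symmetric H k parent extra) (Graph.sym result))
             (∖-irreflexive (slotAdj H k parent extra) (adj result)
                            (slotAdj-irreflexive H k parent extra))) ⟩
      missingEdges t H (label ℓ) + 2 * excess
        ≡⟨ +-comm _ (2 * excess) ⟩
      2 * excess + missingEdges t H (label ℓ) ∎
      where
      open ≤-Reasoning
      missing-cover : ∀ a b → T ((gminE (suc t) (ℓ′ a) (ℓ′ b)) ∧ not (adj result a b)) →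
                      T (extendOld k oldMissing a b ∨ deleted a b)
      missing-cover a b e with e′ , kept ← Equivalence.to T-∧ e =
        Equivalence.from T-∨
          (map₂ (λ s → Equivalence.from T-∧ (s , kept)) (gminE-relabel-cover a b e′))

missingEdges-schedule : ∀ {d m} {H : Graph m} {s m′ F e} → Schedule d H s m′ F e →
                        ∀ t (ℓ : Labelling m (2 ^ t)) →
                        Σ (Labelling m′ (2 ^ (t + s))) λ ℓF →
                          missingEdges (t + s) F (label ℓF) ≤ 2 * e + missingEdges t H (label ℓ)
missingEdges-schedule done t ℓ rewrite +-identityʳ t = ℓ , ≤-refl
missingEdges-schedule {H = H} (step {s} {F = F} {e} σ rest) t ℓ rewrite +-suc t s
  with ℓF , bound ← missingEdges-schedule rest (suc t) (relabelling σ ℓ) = ℓF , (begin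
    missingEdges (suc t + s) F (label ℓF)
      ≤⟨ bound ⟩
    2 * e + missingEdges (suc t) (Slot.result σ) (relabel σ (2 ^ t) (label ℓ))
      ≤⟨ +-monoʳ-≤ (2 * e) (missingEdges-slot σ t ℓ) ⟩
    2 * e + (2 * Slot.excess σ + missingEdges t H (label ℓ))
      ≡⟨ regroup e (Slot.excess σ) _ ⟩
    2 * (Slot.excess σ + e) + missingEdges t H (label ℓ) ∎)
  where
  open ≤-Reasoning
  regroup : ∀ x y z → 2 * x + (2 * y + z) ≡ 2 * (y + x) + z
  regroup = solve-∀

injective⇒surjective : ∀ {m n} {f : Fin m → Fin n} →
                       Injective _≡_ _≡_ f → n ≤ m → Surjective _≡_ _≡_ f
injective⇒surjective {n = suc n} {f} f-injective n≤m y with any? (λ x → f x Fin.≟ y)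
... | yes (x , fx≡y) = x , λ { refl → fx≡y }
... | no ∄x = ⊥-elim (n≮n n (≤-trans n≤m (injective⇒≤ punched-injective)))
  where
  y≢f : ∀ x → y ≢ f x
  y≢f x y≡fx = ∄x (x , sym y≡fx)

  punched-injective : Injective _≡_ _≡_ (λ x → punchOut (y≢f x))
  punched-injective {x} {x′} eq = f-injective (punchOut-injective (y≢f x) (y≢f x′) eq)

ED-of-labelling : ∀ δ (G : Graph (2 ^ δ)) {m} (F : Graph m) → Iso F G →
                  (ℓ : Labelling m (2 ^ δ)) →
                  Σ (Fin (2 ^ δ) ⤖ Fin (2 ^ δ)) λ b → 2 * ED δ G b ≡ missingEdges δ F (label ℓ)
ED-of-labelling δ G {m} F (f , f-iso) ℓ = b , (begin
  2 * ED δ G b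
    ≡⟨ orderedCount-symmetric missingᵇ
         (∖-symmetric (λ u v → gminE-symmetric δ (toℕ u) (toℕ v))
                      (λ u v → Graph.sym G (to b u) (to b v)))
         (∖-irreflexive (Gmin-adj δ) (λ u v → adj G (to b u) (to b v))
                        (λ u → gminE-irreflexive δ (toℕ u))) ⟨
  orderedCount missingᵇ
    ≡⟨ orderedCount-reindex π missingᵇ ⟩
  orderedCount (λ i j → missingᵇ (ρ i) (ρ j))
    ≡⟨ sum-cong-≗ (λ i → sum-cong-≗ λ j → cong ⟦_⟧ (missingᵇ-ρ i j)) ⟩
  missingEdges δ F (label ℓ) ∎)
  where
  open ≡-Reasoning
  open Bijection using (to)

  ρ : Fin m → Fin (2 ^ δ)
  ρ i = fromℕ< (bounded ℓ i)

  toℕ-ρ : ∀ i → toℕ (ρ i) ≡ label ℓ i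
  toℕ-ρ i = toℕ-fromℕ< (bounded ℓ i)

  ρ-injective : Injective _≡_ _≡_ ρ
  ρ-injective eq = injective ℓ (subst₂ _≡_ (toℕ-ρ _) (toℕ-ρ _) (cong toℕ eq))

  π : Fin m ↔ Fin (2 ^ δ)
  π = ⤖⇒↔ (mk⤖ (ρ-injective , injective⇒surjective ρ-injective
         (injective⇒≤ (Injection.injective (↔⇒↣ (↔-sym (⤖⇒↔ f)))))))

  b : Fin (2 ^ δ) ⤖ Fin (2 ^ δ)
  b = f ⤖-∘ ↔⇒⤖ (↔-sym π)

  missingᵇ : Rel (2 ^ δ)
  missingᵇ = Gmin-adj δ ∖ λ u v → adj G (to b u) (to b v)

  b-ρ : ∀ i → to b (ρ i) ≡ to f i
  b-ρ i = cong (to f) (Inverse.strictlyInverseʳ π i)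

  missingᵇ-ρ : ∀ i j → missingᵇ (ρ i) (ρ j) ≡ gminE δ (label ℓ i) (label ℓ j) ∧ not (adj F i j)
  missingᵇ-ρ i j = cong₂ (λ x y → x ∧ not y) (cong₂ (gminE δ) (toℕ-ρ i) (toℕ-ρ j))
    (trans (cong₂ (adj G) (b-ρ i) (b-ρ j)) (f-iso i j))

G₀-labelling : Labelling 1 (2 ^ 0)
G₀-labelling = record
  { label     = const 0
  ; injective = λ { {fzero} {fzero} _ → refl }
  ; bounded   = λ _ → s≤s z≤n
  }

mainTheorem13 : (δ : ℕ) (G : Graph (2 ^ δ)) {m : ℕ} (F : Graph m) (e : ℕ) →
                Schedule 2 G₀ δ m F e → Iso F G →
                Σ (Fin (2 ^ δ) ⤖ Fin (2 ^ δ)) (λ b → ED δ G b ≤ e)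
mainTheorem13 δ G F e schedule F≅G
  with ℓ , bound ← missingEdges-schedule schedule 0 G₀-labelling
  with b , 2ED≡missing ← ED-of-labelling δ G F F≅G ℓ
  = b , *-cancelˡ-≤ 2 (begin
    2 * ED δ G b               ≡⟨ 2ED≡missing ⟩
    missingEdges δ F (label ℓ) ≤⟨ bound ⟩
    2 * e + 0                  ≡⟨ +-identityʳ (2 * e) ⟩
    2 * e                      ∎)
  where open ≤-Reasoning
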